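{- Let $\mathbf u$ be the simple Parry sequence with parameters $m\ge 2$, $t_1,\dots,t_m$, and $u_n=\varphi^n(0)$. For each $n\in\mathbb N$, $n\ge 1$, and all $k_1,\dots,k_n\in\mathbb N$ such that $k_ik_{i+1}\cdots k_n0^{\omega}\prec_{\mathrm{lex}} t_1t_2\cdots t_m0^{\omega}$ for all $i\in\{1,\dots,n\}$, the word $u_{n-1}^{k_1}u_{n-2}^{k_2}\cdots u_0^{k_n}$ is a prefix of $u_n$.
   Context: Simple Parry sequence: let $m\in\mathbb N$, $m\ge2$, and $t_1,\dots,t_m\in\mathbb N$ with $t_1\ge1$, $t_m\ge1$ and $t_it_{i+1}\cdots t_m0^{\omega}\prec_{\mathrm{lex}}t_1t_2\cdots t_m0^{\omega}$ for each $i\in\{2,\dots,m\}$. Let $\varphi$ be the morphism on $\{0,1,\dots,m-1\}^*$ given by $\varphi(j)=0^{t_{j+1}}(j+1)$ for $0\le j\le m-2$ and $\varphi(m-1)=0^{t_m}$; $\mathbf u$ is its fixed point starting with $0$. Here $\prec_{\mathrm{lex}}$ is the lexicographic order on infinite sequences of nonnegative integers ($\mathbf a\prec_{\mathrm{lex}}\mathbf b$ iff at the first index where they differ, $\mathbf a$ has the smaller entry). $u_n=\varphi^n(0)$. -}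

module Defs where

open import Data.Nat using (ℕ; zero; suc; _<_; _<?_)
open import Data.List using (List; []; _∷_; _++_; replicate; concatMap)
open import Data.Product using (Σ; _×_)
open import Relation.Binary.PropositionalEquality using (_≡_)
open import Relation.Nullary using (yes; no)

at : List ℕ → ℕ → ℕ
at []       _       = 0
at (x ∷ xs) zero    = x
at (x ∷ xs) (suc i) = at xs i

-- the infinite sequence  w 0^ω  for a finite word w
pad : List ℕ → (ℕ → ℕ)
pad w i = at w i

_≺lex_ : (ℕ → ℕ) → (ℕ → ℕ) → Set
a ≺lex b = Σ ℕ λ j → ((i : ℕ) → i < j → a i ≡ b i) × (a j < b j)

-- the Parry morphism φ on letters 0..m-1 (letters are naturals),
-- ts = t₁ … t_m (so t_{j+1} = at ts j):
--   φ(j) = 0^{t_{j+1}} (j+1)   if j+1 < m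
--   φ(m-1) = 0^{t_m}
φ-letter : ℕ → List ℕ → ℕ → List ℕ
φ-letter m ts j with suc j <? m
... | yes _ = replicate (at ts j) 0 ++ (suc j ∷ [])
... | no  _ = replicate (at ts j) 0

φ : ℕ → List ℕ → List ℕ → List ℕ
φ m ts = concatMap (φ-letter m ts)

uₙ : ℕ → List ℕ → ℕ → List ℕ
uₙ m ts zero    = 0 ∷ []
uₙ m ts (suc n) = φ m ts (uₙ m ts n)

pow : List ℕ → ℕ → List ℕ
pow w zero    = []
pow w (suc k) = w ++ pow w k

-- for ks = k₁ … kₙ :  u_{n-1}^{k₁} u_{n-2}^{k₂} ⋯ u_0^{kₙ}
block : ℕ → List ℕ → List ℕ → List ℕ
block m ts []       = []
block m ts (k ∷ ks) = pow (uₙ m ts (Data.List.length ks)) k ++ block m ts ks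

-- Strengthen the claim to an arbitrary starting letter j: if k₁k₂⋯ 0^ω ≺lex t_{j+1}t_{j+2}⋯ 0^ω
-- and every suffix of k lies below t, then u_{n-1}^{k₁}⋯u_0^{kₙ} is a prefix of φⁿ(j).
-- With U = u_{n-1} we have φⁿ(j) = U^{t_{j+1}} φ^{n-1}(j+1), the last factor being absent for
-- j = m-1. If k₁ < t_{j+1}, the induction hypothesis at letter 0 puts the word inside
-- U^{k₁} U, a prefix of U^{t_{j+1}}; if k₁ = t_{j+1}, the tail k₂k₃⋯ lies below t_{j+2}t_{j+3}⋯,
-- which is the induction hypothesis at letter j+1 (and is impossible when j = m-1).
module Submission where

open import Defs
open import Data.Nat using (ℕ; zero; suc; _≤_; _<_; _∸_; _<?_; z≤n; s≤s)
open import Data.Nat.Properties using (≤-reflexive; ≤-trans; ≮⇒≥)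
open import Data.Vec using (Vec; toList)
open import Data.Vec.Properties using (length-toList)
open import Data.List using (List; []; _∷_; [_]; drop; _++_; replicate; concatMap; length)
open import Data.List.Properties using (++-monoid; ++-assoc; ++-identityʳ; concatMap-++; drop-all)
open import Data.Product using (Σ; _×_; _,_)
open import Data.Sum using (_⊎_; inj₁; inj₂)
open import Function using (_∘_)
open import Relation.Nullary using (¬_; yes; no; contradiction)
open import Relation.Binary.PropositionalEquality using (_≡_; _≗_; refl; sym; trans; cong; subst)
open import Algebra.Properties.Monoid.Divisibility (++-monoid ℕ)
  using (_∣ˡ_; _,_; ε∣ˡ_; ∣ˡ-respˡ-≈; ∣ˡ-respʳ-≈; x∣ˡy⇒zx∣ˡzy; ∣ˡ-preorder)
open import Relation.Binary.Reasoning.Preorder ∣ˡ-preorder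

∣ˡ⇒++ : {a b : List ℕ} → a ∣ˡ b → Σ (List ℕ) λ w → a ++ w ≡ b
∣ˡ⇒++ (w , a++w≡b) = w , a++w≡b

≺lex-uncons : {a b : ℕ → ℕ} → a ≺lex b → a 0 < b 0 ⊎ (a 0 ≡ b 0 × (a ∘ suc) ≺lex (b ∘ suc))
≺lex-uncons (zero  , _     , a₀<b₀) = inj₁ a₀<b₀
≺lex-uncons (suc j , agree , aⱼ<bⱼ) =
  inj₂ (agree 0 (s≤s z≤n) , j , (λ i i<j → agree (suc i) (s≤s i<j)) , aⱼ<bⱼ)

≺lex-respʳ : {a b c : ℕ → ℕ} → b ≗ c → a ≺lex b → a ≺lex c
≺lex-respʳ b≗c (j , agree , aⱼ<bⱼ) =
  j , (λ i i<j → trans (agree i i<j) (b≗c i)) , subst (_ <_) (b≗c j) aⱼ<bⱼ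

≺lex-zero : {a : ℕ → ℕ} → ¬ a ≺lex (λ _ → 0)
≺lex-zero (_ , _ , ())

zero-≺lex : {b : ℕ → ℕ} → 0 < b 0 → (λ _ → 0) ≺lex b
zero-≺lex 0<b₀ = 0 , (λ _ ()) , 0<b₀

at-drop-zero : ∀ xs j → at (drop j xs) 0 ≡ at xs j
at-drop-zero xs       zero    = refl
at-drop-zero []       (suc j) = refl
at-drop-zero (x ∷ xs) (suc j) = at-drop-zero xs j

pad-drop-suc : ∀ xs j → pad (drop j xs) ∘ suc ≗ pad (drop (suc j) xs)
pad-drop-suc []       zero    i = refl
pad-drop-suc (x ∷ xs) zero    i = refl
pad-drop-suc []       (suc j) i = refl
pad-drop-suc (x ∷ xs) (suc j) i = pad-drop-suc xs j i

pow-snoc-∣ˡ : ∀ w {k l} → k < l → (pow w k ++ w) ∣ˡ pow w l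
pow-snoc-∣ˡ w {zero}  {suc l} _         = pow w l , refl
pow-snoc-∣ˡ w {suc k} {suc l} (s≤s k<l) =
  ∣ˡ-respˡ-≈ (sym (++-assoc w (pow w k) w)) (x∣ˡy⇒zx∣ˡzy w (pow-snoc-∣ˡ w k<l))

module Substitution (σ : ℕ → List ℕ) where

  σ^ : ℕ → List ℕ → List ℕ
  σ^ zero    w = w
  σ^ (suc n) w = concatMap σ (σ^ n w)

  σ^-[] : ∀ n → σ^ n [] ≡ []
  σ^-[] zero    = refl
  σ^-[] (suc n) = cong (concatMap σ) (σ^-[] n)

  σ^-++ : ∀ n a b → σ^ n (a ++ b) ≡ σ^ n a ++ σ^ n b
  σ^-++ zero    a b = refl
  σ^-++ (suc n) a b =
    trans (cong (concatMap σ) (σ^-++ n a b)) (concatMap-++ σ (σ^ n a) (σ^ n b))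

  σ^-mono-∣ˡ : ∀ n {a b} → a ∣ˡ b → σ^ n a ∣ˡ σ^ n b
  σ^-mono-∣ˡ n {a} (w , refl) = σ^ n w , sym (σ^-++ n a w)

  σ^-replicate : ∀ n k x → σ^ n (replicate k x) ≡ pow (σ^ n [ x ]) k
  σ^-replicate n zero    x = σ^-[] n
  σ^-replicate n (suc k) x =
    trans (σ^-++ n [ x ] (replicate k x)) (cong (σ^ n [ x ] ++_) (σ^-replicate n k x))

  σ^-suc-letter : ∀ n x → σ^ (suc n) [ x ] ≡ σ^ n (σ x)
  σ^-suc-letter zero    x = ++-identityʳ (σ x)
  σ^-suc-letter (suc n) x = cong (concatMap σ) (σ^-suc-letter n x)

module Parry (m : ℕ) (t : List ℕ) where

  open Substitution (φ-letter m t) public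
    renaming (σ^ to φ^; σ^-++ to φ^-++; σ^-mono-∣ˡ to φ^-mono-∣ˡ;
              σ^-replicate to φ^-replicate; σ^-suc-letter to φ^-suc-letter)

  uₙ≡φ^ : ∀ n → uₙ m t n ≡ φ^ n [ 0 ]
  uₙ≡φ^ zero    = refl
  uₙ≡φ^ (suc n) = cong (φ m t) (uₙ≡φ^ n)

  φ-letter-< : ∀ {j} → suc j < m → φ-letter m t j ≡ replicate (at t j) 0 ++ [ suc j ]
  φ-letter-< {j} j+1<m with suc j <? m
  ... | yes _     = refl
  ... | no j+1≮m = contradiction j+1<m j+1≮m

  replicate-∣ˡ-φ-letter : ∀ j → replicate (at t j) 0 ∣ˡ φ-letter m t j
  replicate-∣ˡ-φ-letter j with suc j <? m
  ... | yes _ = [ suc j ] , refl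
  ... | no _  = [] , ++-identityʳ _

  φ^-replicate-zero : ∀ n k → φ^ n (replicate k 0) ≡ pow (uₙ m t n) k
  φ^-replicate-zero n k = trans (φ^-replicate n k 0) (cong (λ u → pow u k) (sym (uₙ≡φ^ n)))

  pow-uₙ-∣ˡ-φ^ : ∀ n j → pow (uₙ m t n) (at t j) ∣ˡ φ^ (suc n) [ j ]
  pow-uₙ-∣ˡ-φ^ n j = begin
    pow (uₙ m t n) (at t j)       ≡⟨ φ^-replicate-zero n (at t j) ⟨
    φ^ n (replicate (at t j) 0)  ≲⟨ φ^-mono-∣ˡ n (replicate-∣ˡ-φ-letter j) ⟩
    φ^ n (φ-letter m t j)        ≡⟨ φ^-suc-letter n j ⟨
    φ^ (suc n) [ j ]             ∎

  φ^-suc-< : ∀ n {j} → suc j < m →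
             φ^ (suc n) [ j ] ≡ pow (uₙ m t n) (at t j) ++ φ^ n [ suc j ]
  φ^-suc-< n {j} j+1<m = begin-equality
    φ^ (suc n) [ j ]                                  ≡⟨ φ^-suc-letter n j ⟩
    φ^ n (φ-letter m t j)                             ≡⟨ cong (φ^ n) (φ-letter-< j+1<m) ⟩
    φ^ n (replicate (at t j) 0 ++ [ suc j ])          ≡⟨ φ^-++ n (replicate (at t j) 0) [ suc j ] ⟩
    φ^ n (replicate (at t j) 0) ++ φ^ n [ suc j ]     ≡⟨ cong (_++ φ^ n [ suc j ]) (φ^-replicate-zero n (at t j)) ⟩
    pow (uₙ m t n) (at t j) ++ φ^ n [ suc j ]         ∎

  Admissible : List ℕ → Set
  Admissible ks = ∀ i → pad (drop i ks) ≺lex pad t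

  admissible : 0 < at t 0 → ∀ ks → (∀ i → i < length ks → pad (drop i ks) ≺lex pad t) →
               Admissible ks
  admissible 0<t₁ ks below i with i <? length ks
  ... | yes i<len = below i i<len
  ... | no i≮len  = subst (λ s → pad s ≺lex pad t) (sym (drop-all i ks (≮⇒≥ i≮len)))
                          (zero-≺lex 0<t₁)

  block-∣ˡ-φ^ : length t ≤ m → ∀ {ks} → Admissible ks →
                ∀ j → pad ks ≺lex pad (drop j t) → block m t ks ∣ˡ φ^ (length ks) [ j ]
  block-∣ˡ-φ^ _   {[]}     _   _ _   = ε∣ˡ _
  block-∣ˡ-φ^ len {k ∷ ks} adm j lex with ≺lex-uncons lex
  ... | inj₁ k<tⱼ = begin
    pow U k ++ block m t ks     ≲⟨ x∣ˡy⇒zx∣ˡzy (pow U k) tail-∣ˡ-U ⟩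
    pow U k ++ U                ≲⟨ pow-snoc-∣ˡ U (subst (k <_) (at-drop-zero t j) k<tⱼ) ⟩
    pow U (at t j)              ≲⟨ pow-uₙ-∣ˡ-φ^ (length ks) j ⟩
    φ^ (suc (length ks)) [ j ]  ∎
    where
    U : List ℕ
    U = uₙ m t (length ks)
    tail-∣ˡ-U : block m t ks ∣ˡ U
    tail-∣ˡ-U = ∣ˡ-respʳ-≈ (sym (uₙ≡φ^ (length ks))) (block-∣ˡ-φ^ len (adm ∘ suc) 0 (adm 1))
  ... | inj₂ (k≡tⱼ , lex′) with suc j <? m
  ...   | yes j+1<m = begin
    pow U k ++ block m t ks                     ≡⟨ cong (λ e → pow U e ++ block m t ks) k≡tⱼ′ ⟩
    pow U (at t j) ++ block m t ks              ≲⟨ x∣ˡy⇒zx∣ˡzy (pow U (at t j)) tail-∣ˡ ⟩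
    pow U (at t j) ++ φ^ (length ks) [ suc j ]  ≡⟨ φ^-suc-< (length ks) j+1<m ⟨
    φ^ (suc (length ks)) [ j ]                  ∎
    where
    U : List ℕ
    U = uₙ m t (length ks)
    k≡tⱼ′ : k ≡ at t j
    k≡tⱼ′ = trans k≡tⱼ (at-drop-zero t j)
    tail-∣ˡ : block m t ks ∣ˡ φ^ (length ks) [ suc j ]
    tail-∣ˡ = block-∣ˡ-φ^ len (adm ∘ suc) (suc j) (≺lex-respʳ (pad-drop-suc t j) lex′)
  ...   | no j+1≮m = contradiction tail-below-zero ≺lex-zero
    where
    tail-below-zero : pad ks ≺lex pad []
    tail-below-zero = subst (λ s → pad ks ≺lex pad s)
                            (drop-all (suc j) t (≤-trans len (≮⇒≥ j+1≮m)))
                            (≺lex-respʳ (pad-drop-suc t j) lex′)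

lemma4p6 : (m : ℕ) → 2 ≤ m → (t : Vec ℕ m) →
           1 ≤ at (toList t) 0 → 1 ≤ at (toList t) (m ∸ 1) →
           ((i : ℕ) → 1 ≤ i → i < m → pad (drop i (toList t)) ≺lex pad (toList t)) →
           (n : ℕ) → 1 ≤ n → (k : Vec ℕ n) →
           ((i : ℕ) → i < n → pad (drop i (toList k)) ≺lex pad (toList t)) →
           Σ (List ℕ) λ w → block m (toList t) (toList k) ++ w ≡ uₙ m (toList t) n
lemma4p6 m _ t 0<t₁ _ _ n _ k below = ∣ˡ⇒++ block-prefix
  where
  open Parry m (toList t)
  adm : Admissible (toList k)
  adm = admissible 0<t₁ (toList k) (λ i i<len → below i (subst (i <_) (length-toList k) i<len))
  block-prefix : block m (toList t) (toList k) ∣ˡ uₙ m (toList t) n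
  block-prefix = begin
    block m (toList t) (toList k)  ≲⟨ block-∣ˡ-φ^ (≤-reflexive (length-toList t)) adm 0 (adm 0) ⟩
    φ^ (length (toList k)) [ 0 ]   ≡⟨ cong (λ l → φ^ l [ 0 ]) (length-toList k) ⟩
    φ^ n [ 0 ]                     ≡⟨ uₙ≡φ^ n ⟨
    uₙ m (toList t) n              ∎
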